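{- Let $\mathcal{Q}^{+}(5,2)$ be a hyperbolic quadric in $\mathrm{PG}(5,2)$, let $\mathcal{P}$ be the set of the $28$ points of $\mathrm{PG}(5,2)$ off $\mathcal{Q}^{+}(5,2)$ and $\mathcal{L}$ the set of the $56$ lines of $\mathrm{PG}(5,2)$ skew to $\mathcal{Q}^{+}(5,2)$. Let $0\le m\le 6$ and let $H_1,\dots,H_m$ be $m$ distinct Conwell heptads of $\mathcal{Q}^{+}(5,2)$. Remove from $(\mathcal{P},\mathcal{L})$ all points of $H_1\cup\dots\cup H_m$ together with all lines of $\mathcal{L}$ containing at least one removed point (equivalently, the lines joining pairs of points of a removed heptad). Then the remaining incidence structure is isomorphic to the combinatorial Grassmannian $G_2(8-m)$; that is, one successively obtains configurations $(28_6,56_3)\cong G_2(8)$, $(21_5,35_3)\cong G_2(7)$, $(15_4,20_3)\cong G_2(6)$ (Cayley–Salmon), $(10_3,10_3)\cong G_2(5)$ (Desargues), $(6_2,4_3)\cong G_2(4)$ (Pasch), $(3_1,1_3)\cong G_2(3)$ (a single line) and $(1_0,0_3)\cong G_2(2)$ (a single point); removing a seventh heptad leaves the empty set.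
   Context: A hyperbolic quadric $\mathcal{Q}^{+}(5,2)$ of $\mathrm{PG}(5,2)$ is, up to a change of coordinates, the set of points satisfying $x_1x_2+x_3x_4+x_5x_6=0$ over $\mathbb{F}_2$. A Conwell heptad of $\mathcal{Q}^{+}(5,2)$ is a set of seven points off the quadric such that every line joining two distinct points of the set is skew to $\mathcal{Q}^{+}(5,2)$; there are exactly eight such heptads, any two sharing exactly one point. The incidence structure $(\mathcal{P},\mathcal{L})$ has incidence given by containment in $\mathrm{PG}(5,2)$. For a positive integer $k$ and an $N$-element set $X$, the combinatorial Grassmannian $G_k(N)$ is the incidence structure whose points are the $k$-element subsets of $X$ and whose lines are the $(k+1)$-element subsets, incidence being inclusion. An $(n_r,b_k)$-configuration has $n$ points, $b$ lines, $r$ lines through each point and $k$ points on each line. -}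

module Defs where

open import Data.Bool using (Bool; true; false; _∧_; _∨_; not; T; if_then_else_)
open import Data.Nat using (ℕ; zero; suc; _+_; _≡ᵇ_)
open import Data.Fin using (Fin)
import Data.Fin as Fin
open import Data.Fin.Subset using (Subset; ∣_∣; _⊆_)
open import Data.Vec using (Vec; []; _∷_; zipWith)
open import Data.Product using (Σ; _×_; _,_; proj₁)
open import Function.Bundles using (_↔_; Inverse; _⇔_)
open import Relation.Binary.PropositionalEquality using (_≡_)
open import Relation.Nullary using (¬_)

-- Vectors of F₂⁶ (F₂ = Bool, addition = xor)

V : Set
V = Vec Bool 6

xor : Bool → Bool → Bool
xor true b = not b
xor false b = b

_⊕_ : ∀ {n} → Vec Bool n → Vec Bool n → Vec Bool n
_⊕_ = zipWith xor

zeroV : ∀ {n} → Vec Bool n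
zeroV {zero} = []
zeroV {suc n} = false ∷ zeroV

_==_ : ∀ {n} → Vec Bool n → Vec Bool n → Bool
[] == [] = true
(a ∷ u) == (b ∷ v) = (if a then b else not b) ∧ (u == v)

Q : V → Bool
Q (x1 ∷ x2 ∷ x3 ∷ x4 ∷ x5 ∷ x6 ∷ []) = xor (x1 ∧ x2) (xor (x3 ∧ x4) (x5 ∧ x6))

-- A point of PG(5,2) is a nonzero vector of F₂⁶ (over F₂ each projective
-- point has exactly one nonzero representative).  A point x lies off the
-- quadric Q⁺(5,2) iff Q x = true (which forces x ≠ 0).

-- Finite sets of vectors of F₂ⁿ, as a complete binary tree of
-- membership bits (so that equal sets are propositionally equal).

BSet : ℕ → Set
BSet zero = Bool
BSet (suc n) = BSet n × BSet n

_∈ᵇ_ : ∀ {n} → Vec Bool n → BSet n → Bool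
[] ∈ᵇ b = b
(false ∷ v) ∈ᵇ (l , r) = v ∈ᵇ l
(true ∷ v) ∈ᵇ (l , r) = v ∈ᵇ r

tabulate : ∀ {n} → (Vec Bool n → Bool) → BSet n
tabulate {zero} f = f []
tabulate {suc n} f = tabulate (λ v → f (false ∷ v)) , tabulate (λ v → f (true ∷ v))

count : ∀ {n} → BSet n → ℕ
count {zero} true = 1
count {zero} false = 0
count {suc n} (l , r) = count l + count r

allV : ∀ {n} → (Vec Bool n → Bool) → Bool
allV {zero} f = f []
allV {suc n} f = allV (λ v → f (false ∷ v)) ∧ allV (λ v → f (true ∷ v))

_⇒ᵇ_ : Bool → Bool → Bool
a ⇒ᵇ b = not a ∨ b

-- Lines of PG(5,2): sets of exactly 3 nonzero vectors closed under the
-- sum of any two distinct members (= the 3 points of a 2-dim subspace).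

isLine : BSet 6 → Bool
isLine S = (count S ≡ᵇ 3) ∧ not (zeroV ∈ᵇ S)
  ∧ allV (λ x → allV (λ y →
      ((x ∈ᵇ S) ∧ (y ∈ᵇ S) ∧ not (x == y)) ⇒ᵇ ((x ⊕ y) ∈ᵇ S)))

isSkew : BSet 6 → Bool
isSkew S = allV (λ x → (x ∈ᵇ S) ⇒ᵇ Q x)

lineThrough : V → V → BSet 6
lineThrough x y = tabulate (λ z → (z == x) ∨ (z == y) ∨ (z == (x ⊕ y)))

IsConwellHeptad : BSet 6 → Set
IsConwellHeptad H =
  (count H ≡ 7)
  × (∀ x → T (x ∈ᵇ H) → T (Q x))
  × (∀ x y → T (x ∈ᵇ H) → T (y ∈ᵇ H) → ¬ (x ≡ y) → T (isSkew (lineThrough x y)))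

anyFin : ∀ {m} → (Fin m → Bool) → Bool
anyFin {zero} f = false
anyFin {suc m} f = f Fin.zero ∨ anyFin (λ i → f (Fin.suc i))

removed : ∀ {m} → (Fin m → BSet 6) → V → Bool
removed H x = anyFin (λ i → x ∈ᵇ H i)

RemPoint : ∀ {m} → (Fin m → BSet 6) → Set
RemPoint H = Σ V (λ x → T (Q x ∧ not (removed H x)))

RemLine : ∀ {m} → (Fin m → BSet 6) → Set
RemLine H = Σ (BSet 6) (λ S → T (isLine S ∧ isSkew S
                                  ∧ allV (λ x → (x ∈ᵇ S) ⇒ᵇ not (removed H x))))

RemInc : ∀ {m} (H : Fin m → BSet 6) → RemPoint H → RemLine H → Set
RemInc H (x , _) (S , _) = T (x ∈ᵇ S)

GPoint : ℕ → ℕ → Set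
GPoint k N = Σ (Subset N) (λ s → ∣ s ∣ ≡ k)

GLine : ℕ → ℕ → Set
GLine k N = Σ (Subset N) (λ s → ∣ s ∣ ≡ suc k)

GInc : ∀ k N → GPoint k N → GLine k N → Set
GInc k N (s , _) (t , _) = s ⊆ t

record IncIso (P L P' L' : Set) (I : P → L → Set) (I' : P' → L' → Set) : Set₁ where
  field
    pointBij : P ↔ P'
    lineBij  : L ↔ L'
    incidence : ∀ p l → I p l ⇔ I' (Inverse.to pointBij p) (Inverse.to lineBij l)

-- Label the 28 points off the quadric by the 2-subsets of an 8-set:
-- with explicit vectors α₀,…,α₇ (α₇ = 0) the point labelled {i , j} is
-- α i ⊕ α j.  Under this labelling the lines skew to Q are the triangles
-- {ab , bc , ca} of the 3-subsets {a , b , c}, and the eight Conwell heptads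
-- are the stars {kj | j ≠ k} of the labels k (called "heptad k" below).  Removing the heptads of a set R
-- of labels therefore leaves exactly the pairs and triples inside the
-- complement of R, i.e. a copy of G₂(8 ∸ ∣ R ∣).

module Submission where

open import Defs
open import Data.Bool using (Bool; true; false; _∧_; _∨_; not; T)
open import Data.Bool.Properties using (T-∧; T-∨; T-≡; T-irrelevant)
open import Data.Empty using (⊥-elim)
open import Data.Fin using (Fin; zero; suc)
open import Data.Fin.Properties using (all?; suc-injective)
open import Data.Fin.Subset using (Subset; ∣_∣; _⊆_; _∈_; _∉_; _∪_; _∩_; ∁; ⁅_⁆)
import Data.Fin.Subset as Subset
open import Data.Fin.Subset.Properties
  using (∣⊥∣≡0; x∈⁅x⁆; x∈⁅y⁆⇒x≡y; ∉⊥; x∈p∪q⁺; x∈p∪q⁻; ∪-identityˡ; drop-∷-⊆; ⊆-trans; p⊆p∪q; q⊆p∪q;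
         ∣∁p∣≡n∸∣p∣; x∈p⇒x∉∁p; x∉p⇒x∈∁p)
open import Data.Nat using (ℕ; zero; suc; _+_; _∸_; _≤_; z≤n; s≤s; _≤?_; _≡ᵇ_; _≟_)
open import Data.Nat.Properties
  using (≤-refl; ≤-reflexive; ≤-trans; +-mono-≤; +-cancelˡ-≤; +-cancelʳ-≤; ≰⇒>; n<1⇒n≡0;
         ≡-irrelevant; ≡ᵇ⇒≡; ≡⇒≡ᵇ)
open import Data.Product using (Σ; ∃; ∃₂; _×_; _,_; proj₁; proj₂)
open import Data.Sum using (_⊎_; inj₁; inj₂; map₂)
open import Data.Unit using (tt)
open import Data.Vec using (Vec; []; _∷_; lookup; tail; here; there)
import Data.Vec as Vec
open import Data.Vec.Properties using ([]=⇒lookup; lookup⇒[]=; lookup∘tabulate)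
open import Function using (_∘_)
open import Function.Bundles using (_↔_; _⇔_; Inverse; Equivalence; mk↔ₛ′; mk⇔)
open import Function.Construct.Composition using (_↔-∘_; _⇔-∘_)
open import Function.Definitions using (Injective)
open import Relation.Binary.PropositionalEquality
  using (_≡_; _≢_; refl; sym; trans; cong; cong₂; subst; subst₂)
open import Relation.Nullary using (¬_; yes; no)
open import Relation.Nullary.Decidable using (toWitness)

∧-intro : ∀ {a b} → T a → T b → T (a ∧ b)
∧-intro p q = Equivalence.from T-∧ (p , q)

∧-elim : ∀ {a b} → T (a ∧ b) → T a × T b
∧-elim = Equivalence.to T-∧

∧-elim₃ : ∀ {a b c} → T (a ∧ b ∧ c) → T a × T b × T c
∧-elim₃ p = let (a , bc) = ∧-elim p in a , ∧-elim bc

∨-elim : ∀ {a b} → T (a ∨ b) → T a ⊎ T b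
∨-elim = Equivalence.to T-∨

⇒ᵇ-elim : ∀ a {b} → T (a ⇒ᵇ b) → T a → T b
⇒ᵇ-elim true p _ = p

⇒ᵇ-intro : ∀ a {b} → (T a → T b) → T (a ⇒ᵇ b)
⇒ᵇ-intro false _ = tt
⇒ᵇ-intro true f = f tt

not-intro : ∀ {a} → ¬ T a → T (not a)
not-intro {false} _ = tt
not-intro {true} ¬a = ¬a tt

not-elim : ∀ {a} → T (not a) → ¬ T a
not-elim {false} _ ()

==-sound : ∀ {n} (x y : Vec Bool n) → T (x == y) → x ≡ y
==-sound [] [] _ = refl
==-sound (true ∷ x) (true ∷ y) p = cong (true ∷_) (==-sound x y p)
==-sound (false ∷ x) (false ∷ y) p = cong (false ∷_) (==-sound x y p)

==-refl : ∀ {n} (x : Vec Bool n) → T (x == x)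
==-refl [] = tt
==-refl (true ∷ x) = ==-refl x
==-refl (false ∷ x) = ==-refl x

≢⇒not== : ∀ {n} (x y : Vec Bool n) → x ≢ y → T (not (x == y))
≢⇒not== x y x≢y = not-intro (x≢y ∘ ==-sound x y)

-- allV decides universal statements over F₂ⁿ; this is how all the finite
-- facts about PG(5,2) below are verified, by evaluation.

allV-sound : ∀ {n} (f : Vec Bool n → Bool) → T (allV f) → ∀ v → T (f v)
allV-sound {zero} f p [] = p
allV-sound {suc n} f p (false ∷ v) = allV-sound (λ u → f (false ∷ u)) (proj₁ (∧-elim p)) v
allV-sound {suc n} f p (true ∷ v) = allV-sound (λ u → f (true ∷ u)) (proj₂ (∧-elim p)) v

allV-complete : ∀ {n} (f : Vec Bool n → Bool) → (∀ v → T (f v)) → T (allV f)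
allV-complete {zero} f h = h []
allV-complete {suc n} f h =
  ∧-intro (allV-complete (λ u → f (false ∷ u)) (h ∘ (false ∷_)))
          (allV-complete (λ u → f (true ∷ u)) (h ∘ (true ∷_)))

decided : ∀ {n} (f : Vec Bool n → Bool) → allV f ≡ true → ∀ v → T (f v)
decided f eq = allV-sound f (subst T (sym eq) tt)

decided₂ : ∀ {m n} (f : Vec Bool m → Vec Bool n → Bool) → allV (λ x → allV (f x)) ≡ true → ∀ x y → T (f x y)
decided₂ f eq x = allV-sound (f x) (decided _ eq x)

anyFin-sound : ∀ {m} (f : Fin m → Bool) → T (anyFin f) → ∃ λ i → T (f i)
anyFin-sound {zero} f ()
anyFin-sound {suc m} f p with ∨-elim p
... | inj₁ f0 = zero , f0
... | inj₂ rest with anyFin-sound (f ∘ suc) rest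
...   | i , fi = suc i , fi

anyFin-complete : ∀ {m} (f : Fin m → Bool) i → T (f i) → T (anyFin f)
anyFin-complete f zero fi = Equivalence.from T-∨ (inj₁ fi)
anyFin-complete f (suc i) fi = Equivalence.from T-∨ (inj₂ (anyFin-complete (f ∘ suc) i fi))

∈-tabulate : ∀ {n} (f : Vec Bool n → Bool) v → v ∈ᵇ tabulate f ≡ f v
∈-tabulate f [] = refl
∈-tabulate f (false ∷ v) = ∈-tabulate (λ u → f (false ∷ u)) v
∈-tabulate f (true ∷ v) = ∈-tabulate (λ u → f (true ∷ u)) v

∈-tabulate⁺ : ∀ {n} (f : Vec Bool n → Bool) v → T (f v) → T (v ∈ᵇ tabulate f)
∈-tabulate⁺ f v = subst T (sym (∈-tabulate f v))

∈-tabulate⁻ : ∀ {n} (f : Vec Bool n → Bool) v → T (v ∈ᵇ tabulate f) → T (f v)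
∈-tabulate⁻ f v = subst T (∈-tabulate f v)

_⊆ˢ_ : ∀ {n} → BSet n → BSet n → Set
A ⊆ˢ B = ∀ v → T (v ∈ᵇ A) → T (v ∈ᵇ B)

count-mono : ∀ {n} (A B : BSet n) → A ⊆ˢ B → count A ≤ count B
count-mono {zero} false B _ = z≤n
count-mono {zero} true true _ = ≤-refl
count-mono {zero} true false A⊆B = ⊥-elim (A⊆B [] tt)
count-mono {suc n} (l , r) (l' , r') A⊆B =
  +-mono-≤ (count-mono l l' (A⊆B ∘ (false ∷_))) (count-mono r r' (A⊆B ∘ (true ∷_)))

+-squeeze : ∀ {a a' b b'} → a ≤ a' → b ≤ b' → a' + b' ≤ a + b → a' ≤ a × b' ≤ b
+-squeeze {a} {a'} {b} {b'} a≤a' b≤b' le =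
  +-cancelʳ-≤ b a' a (≤-trans (+-mono-≤ (≤-refl {a'}) b≤b') le) ,
  +-cancelˡ-≤ a b' b (≤-trans (+-mono-≤ a≤a' (≤-refl {b'})) le)

⊆-count-≡ : ∀ {n} (A B : BSet n) → A ⊆ˢ B → count B ≤ count A → A ≡ B
⊆-count-≡ {zero} false false _ _ = refl
⊆-count-≡ {zero} true true _ _ = refl
⊆-count-≡ {zero} true false A⊆B _ = ⊥-elim (A⊆B [] tt)
⊆-count-≡ {zero} false true _ ()
⊆-count-≡ {suc n} (l , r) (l' , r') A⊆B le =
  cong₂ _,_ (⊆-count-≡ l l' ⊆ˡ (proj₁ squeeze)) (⊆-count-≡ r r' ⊆ʳ (proj₂ squeeze))
  where
  ⊆ˡ : l ⊆ˢ l'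
  ⊆ˡ = A⊆B ∘ (false ∷_)
  ⊆ʳ : r ⊆ˢ r'
  ⊆ʳ = A⊆B ∘ (true ∷_)
  squeeze : count l' ≤ count l × count r' ≤ count r
  squeeze = +-squeeze (count-mono l l' ⊆ˡ) (count-mono r r' ⊆ʳ) le

member : ∀ {n} (A : BSet n) → 1 ≤ count A → ∃ λ v → T (v ∈ᵇ A)
member {zero} true _ = [] , tt
member {suc n} (l , r) p with 1 ≤? count l
... | yes l≥1 = let (v , v∈l) = member l l≥1 in false ∷ v , v∈l
... | no l≱1 = let (v , v∈r) = member r (subst (λ k → 1 ≤ k + count r) (n<1⇒n≡0 (≰⇒> l≱1)) p)
               in true ∷ v , v∈r

TwoMembers : ∀ {n} → BSet n → Set
TwoMembers {n} A = ∃₂ λ (v w : Vec Bool n) → T (v ∈ᵇ A) × T (w ∈ᵇ A) × v ≢ w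

two-members : ∀ {n} (A : BSet n) → 2 ≤ count A → TwoMembers A
two-members {zero} true (s≤s ())
two-members {suc n} (l , r) p with 2 ≤? count l | 2 ≤? count r
... | yes l≥2 | _ = let (v , w , v∈ , w∈ , v≢w) = two-members l l≥2
                    in false ∷ v , false ∷ w , v∈ , w∈ , v≢w ∘ cong tail
... | no _ | yes r≥2 = let (v , w , v∈ , w∈ , v≢w) = two-members r r≥2
                       in true ∷ v , true ∷ w , v∈ , w∈ , v≢w ∘ cong tail
... | no l≱2 | no r≱2 =
  let (l≥1 , r≥1) = both-one l≱2 r≱2 p ; (v , v∈) = member l l≥1 ; (w , w∈) = member r r≥1
  in false ∷ v , true ∷ w , v∈ , w∈ , λ ()
  where
  both-one : ∀ {a b} → ¬ 2 ≤ a → ¬ 2 ≤ b → 2 ≤ a + b → 1 ≤ a × 1 ≤ b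
  both-one {0} {b} _ b≱2 le = ⊥-elim (b≱2 le)
  both-one {1} {0} _ _ (s≤s ())
  both-one {1} {1} _ _ _ = s≤s z≤n , s≤s z≤n
  both-one {1} {suc (suc b)} _ b≱2 _ = ⊥-elim (b≱2 (s≤s (s≤s z≤n)))
  both-one {suc (suc a)} a≱2 _ _ = ⊥-elim (a≱2 (s≤s (s≤s z≤n)))

anyV : ∀ {n} → (Vec Bool n → Bool) → Bool
anyV {zero} f = f []
anyV {suc n} f = anyV (f ∘ (false ∷_)) ∨ anyV (f ∘ (true ∷_))

anyV-sound : ∀ {n} (f : Vec Bool n → Bool) → T (anyV f) → ∃ λ v → T (f v)
anyV-sound {zero} f p = [] , p
anyV-sound {suc n} f p with ∨-elim p
... | inj₁ p₀ = let (v , fv) = anyV-sound (f ∘ (false ∷_)) p₀ in false ∷ v , fv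
... | inj₂ p₁ = let (v , fv) = anyV-sound (f ∘ (true ∷_)) p₁ in true ∷ v , fv

-- Subsets of Fin n.  Boolean inclusion is used where inclusion must be
-- computed (or must have irrelevant proofs); it reflects the library's _⊆_.

_⊆ᵇ_ : ∀ {n} → Subset n → Subset n → Bool
[] ⊆ᵇ [] = true
(a ∷ t) ⊆ᵇ (b ∷ u) = (a ⇒ᵇ b) ∧ (t ⊆ᵇ u)

⊆ᵇ⇒⊆ : ∀ {n} (t u : Subset n) → T (t ⊆ᵇ u) → t ⊆ u
⊆ᵇ⇒⊆ (true ∷ t) (true ∷ u) _ here = here
⊆ᵇ⇒⊆ (true ∷ t) (false ∷ u) () here
⊆ᵇ⇒⊆ (a ∷ t) (b ∷ u) t⊆u (there k∈t) = there (⊆ᵇ⇒⊆ t u (proj₂ (∧-elim t⊆u)) k∈t)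

⊆⇒⊆ᵇ : ∀ {n} (t u : Subset n) → t ⊆ u → T (t ⊆ᵇ u)
⊆⇒⊆ᵇ [] [] _ = tt
⊆⇒⊆ᵇ (false ∷ t) (b ∷ u) t⊆u = ⊆⇒⊆ᵇ t u (drop-∷-⊆ t⊆u)
⊆⇒⊆ᵇ (true ∷ t) (b ∷ u) t⊆u with t⊆u here
... | here = ⊆⇒⊆ᵇ t u (drop-∷-⊆ t⊆u)

∈⇔lookup : ∀ {n} {k : Fin n} {t : Subset n} → k ∈ t ⇔ T (lookup t k)
∈⇔lookup {k = k} {t} = mk⇔
  (λ k∈t → subst T (sym ([]=⇒lookup k∈t)) tt)
  (λ bit → lookup⇒[]= k t (Equivalence.to T-≡ bit))

-- Coordinates inside a fixed subset c: a subset t ⊆ c of Fin n corresponds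
-- to the subset "restrict c t" of Fin ∣ c ∣, and back via "extend c".

restrict : ∀ {n} (c : Subset n) → Subset n → Subset ∣ c ∣
restrict [] [] = []
restrict (true ∷ c) (a ∷ t) = a ∷ restrict c t
restrict (false ∷ c) (a ∷ t) = restrict c t

extend : ∀ {n} (c : Subset n) → Subset ∣ c ∣ → Subset n
extend [] [] = []
extend (true ∷ c) (a ∷ s) = a ∷ extend c s
extend (false ∷ c) s = false ∷ extend c s

extend-restrict : ∀ {n} (c t : Subset n) → T (t ⊆ᵇ c) → extend c (restrict c t) ≡ t
extend-restrict [] [] _ = refl
extend-restrict (true ∷ c) (a ∷ t) t⊆c = cong (a ∷_) (extend-restrict c t (proj₂ (∧-elim t⊆c)))
extend-restrict (false ∷ c) (false ∷ t) t⊆c = cong (false ∷_) (extend-restrict c t t⊆c)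

restrict-extend : ∀ {n} (c : Subset n) s → restrict c (extend c s) ≡ s
restrict-extend [] [] = refl
restrict-extend (true ∷ c) (a ∷ s) = cong (a ∷_) (restrict-extend c s)
restrict-extend (false ∷ c) s = restrict-extend c s

∣restrict∣ : ∀ {n} (c t : Subset n) → T (t ⊆ᵇ c) → ∣ restrict c t ∣ ≡ ∣ t ∣
∣restrict∣ [] [] _ = refl
∣restrict∣ (true ∷ c) (true ∷ t) t⊆c = cong suc (∣restrict∣ c t t⊆c)
∣restrict∣ (true ∷ c) (false ∷ t) t⊆c = ∣restrict∣ c t t⊆c
∣restrict∣ (false ∷ c) (false ∷ t) t⊆c = ∣restrict∣ c t t⊆c

∣extend∣ : ∀ {n} (c : Subset n) s → ∣ extend c s ∣ ≡ ∣ s ∣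
∣extend∣ [] [] = refl
∣extend∣ (true ∷ c) (true ∷ s) = cong suc (∣extend∣ c s)
∣extend∣ (true ∷ c) (false ∷ s) = ∣extend∣ c s
∣extend∣ (false ∷ c) s = ∣extend∣ c s

extend⊆ : ∀ {n} (c : Subset n) s → T (extend c s ⊆ᵇ c)
extend⊆ [] [] = tt
extend⊆ (true ∷ c) (a ∷ s) = ∧-intro (⇒ᵇ-intro a (λ _ → tt)) (extend⊆ c s)
extend⊆ (false ∷ c) s = extend⊆ c s

restrict-⊆ᵇ : ∀ {n} (c t u : Subset n) → T (t ⊆ᵇ c) → t ⊆ᵇ u ≡ restrict c t ⊆ᵇ restrict c u
restrict-⊆ᵇ [] [] [] _ = refl
restrict-⊆ᵇ (true ∷ c) (a ∷ t) (b ∷ u) t⊆c = cong ((a ⇒ᵇ b) ∧_) (restrict-⊆ᵇ c t u (proj₂ (∧-elim t⊆c)))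
restrict-⊆ᵇ (false ∷ c) (false ∷ t) (b ∷ u) t⊆c = restrict-⊆ᵇ c t u t⊆c

_∘ᴵ_ : ∀ {P L P' L' P'' L'' : Set} {I : P → L → Set} {I' : P' → L' → Set} {I'' : P'' → L'' → Set}
  → IncIso P' L' P'' L'' I' I'' → IncIso P L P' L' I I' → IncIso P L P'' L'' I I''
g ∘ᴵ f = record
  { pointBij = IncIso.pointBij g ↔-∘ IncIso.pointBij f
  ; lineBij = IncIso.lineBij g ↔-∘ IncIso.lineBij f
  ; incidence = λ p l → IncIso.incidence g (Inverse.to (IncIso.pointBij f) p) (Inverse.to (IncIso.lineBij f) l)
                          ⇔-∘ IncIso.incidence f p l
  }

Inside : ∀ {n} → ℕ → Subset n → Set
Inside {n} k c = Σ (Subset n) λ t → ∣ t ∣ ≡ k × T (t ⊆ᵇ c)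

InsideInc : ∀ {n} k (c : Subset n) → Inside k c → Inside (suc k) c → Set
InsideInc k c (t , _) (u , _) = t ⊆ u

Inside-≡ : ∀ {n k} {c : Subset n} {a b : Inside k c} → proj₁ a ≡ proj₁ b → a ≡ b
Inside-≡ {a = t , e , p} {.t , e' , p'} refl = cong₂ (λ e p → t , e , p) (≡-irrelevant e e') (T-irrelevant p p')

GPoint-≡ : ∀ {k N} {a b : GPoint k N} → proj₁ a ≡ proj₁ b → a ≡ b
GPoint-≡ {a = s , e} {.s , e'} refl = cong (s ,_) (≡-irrelevant e e')

insideBij : ∀ {n} k (c : Subset n) → Inside k c ↔ GPoint k ∣ c ∣
insideBij k c = mk↔ₛ′ to from
  (λ (s , _) → GPoint-≡ (restrict-extend c s))
  (λ (t , _ , t⊆c) → Inside-≡ (extend-restrict c t t⊆c))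
  where
  to : Inside k c → GPoint k ∣ c ∣
  to (t , ∣t∣≡k , t⊆c) = restrict c t , trans (∣restrict∣ c t t⊆c) ∣t∣≡k
  from : GPoint k ∣ c ∣ → Inside k c
  from (s , ∣s∣≡k) = extend c s , trans (∣extend∣ c s) ∣s∣≡k , extend⊆ c s

insideIso : ∀ {n} k (c : Subset n) →
  IncIso (Inside k c) (Inside (suc k) c) (GPoint k ∣ c ∣) (GLine k ∣ c ∣) (InsideInc k c) (GInc k ∣ c ∣)
insideIso k c = record
  { pointBij = insideBij k c
  ; lineBij = insideBij (suc k) c
  ; incidence = λ (t , _ , t⊆c) (u , _) → ⊆-restrict t u t⊆c
  }
  where
  ⊆-restrict : ∀ t u → T (t ⊆ᵇ c) → t ⊆ u ⇔ restrict c t ⊆ restrict c u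
  ⊆-restrict t u t⊆c = mk⇔ to from
    where
    to : t ⊆ u → restrict c t ⊆ restrict c u
    to t⊆u = ⊆ᵇ⇒⊆ _ _ (subst T (restrict-⊆ᵇ c t u t⊆c) (⊆⇒⊆ᵇ t u t⊆u))
    from : restrict c t ⊆ restrict c u → t ⊆ u
    from t'⊆u' = ⊆ᵇ⇒⊆ t u (subst T (sym (restrict-⊆ᵇ c t u t⊆c)) (⊆⇒⊆ᵇ _ _ t'⊆u'))

image : ∀ {m n} → (Fin m → Fin n) → Subset n
image {zero} c = Subset.⊥
image {suc m} c = ⁅ c zero ⁆ ∪ image (c ∘ suc)

∈-image : ∀ {m n} (c : Fin m → Fin n) i → c i ∈ image c
∈-image c zero = x∈p∪q⁺ (inj₁ (x∈⁅x⁆ (c zero)))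
∈-image c (suc i) = x∈p∪q⁺ (inj₂ (∈-image (c ∘ suc) i))

image-∈ : ∀ {m n} (c : Fin m → Fin n) {k} → k ∈ image c → ∃ λ i → c i ≡ k
image-∈ {zero} c k∈ = ⊥-elim (∉⊥ k∈)
image-∈ {suc m} c {k} k∈ with x∈p∪q⁻ ⁅ c zero ⁆ (image (c ∘ suc)) k∈
... | inj₁ k∈⁅c0⁆ = zero , sym (x∈⁅y⁆⇒x≡y (c zero) k∈⁅c0⁆)
... | inj₂ k∈rest = let (i , ci≡k) = image-∈ (c ∘ suc) k∈rest in suc i , ci≡k

∣⁅x⁆∪p∣ : ∀ {n} (x : Fin n) (p : Subset n) → x ∉ p → ∣ ⁅ x ⁆ ∪ p ∣ ≡ suc ∣ p ∣
∣⁅x⁆∪p∣ zero (false ∷ p) _ = cong (suc ∘ ∣_∣) (∪-identityˡ p)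
∣⁅x⁆∪p∣ zero (true ∷ p) x∉p = ⊥-elim (x∉p here)
∣⁅x⁆∪p∣ (suc x) (true ∷ p) x∉p = cong suc (∣⁅x⁆∪p∣ x p (x∉p ∘ there))
∣⁅x⁆∪p∣ (suc x) (false ∷ p) x∉p = ∣⁅x⁆∪p∣ x p (x∉p ∘ there)

∣image∣ : ∀ {m n} (c : Fin m → Fin n) → (∀ {i j} → c i ≡ c j → i ≡ j) → ∣ image c ∣ ≡ m
∣image∣ {zero} {n} c _ = ∣⊥∣≡0 n
∣image∣ {suc m} c inj =
  trans (∣⁅x⁆∪p∣ (c zero) (image (c ∘ suc)) c0∉rest) (cong suc (∣image∣ (c ∘ suc) (suc-injective ∘ inj)))
  where
  c0∉rest : c zero ∉ image (c ∘ suc)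
  c0∉rest c0∈ with image-∈ (c ∘ suc) c0∈
  ... | i , ci≡c0 with inj ci≡c0
  ...   | ()

-- With
-- α₀,…,α₆ the vectors below and α₇ = 0, the 28 sums α i ⊕ α j (i ≠ j) are
-- exactly the points off the quadric, each coming from a unique pair {i , j}.

α : Fin 8 → V
α = lookup
  ( (true  ∷ true  ∷ false ∷ false ∷ false ∷ false ∷ [])
  ∷ (true  ∷ false ∷ true  ∷ true  ∷ false ∷ false ∷ [])
  ∷ (false ∷ true  ∷ true  ∷ true  ∷ true  ∷ false ∷ [])
  ∷ (false ∷ true  ∷ true  ∷ true  ∷ false ∷ true  ∷ [])
  ∷ (false ∷ true  ∷ false ∷ false ∷ true  ∷ true  ∷ [])
  ∷ (true  ∷ false ∷ true  ∷ false ∷ true  ∷ true  ∷ [])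
  ∷ (true  ∷ false ∷ false ∷ true  ∷ true  ∷ true  ∷ [])
  ∷ zeroV
  ∷ [])

pointOf : Subset 8 → V
pointOf = go α
  where
  go : ∀ {n} → (Fin n → V) → Subset n → V
  go v [] = zeroV
  go v (true ∷ t) = v zero ⊕ go (v ∘ suc) t
  go v (false ∷ t) = go (v ∘ suc) t

label : V → Subset 8
label x = Vec.tabulate λ k → anyFin λ j → (α k ⊕ α j) == x

heptad : Fin 8 → BSet 6
heptad k = tabulate λ w → Q w ∧ lookup (label w) k

triangle : Subset 8 → BSet 6
triangle u = tabulate λ w → Q w ∧ (label w ⊆ᵇ u)

labelsOf : BSet 6 → Subset 8
labelsOf S = Vec.tabulate λ k → anyV λ z → (z ∈ᵇ S) ∧ lookup (label z) k

-- w and x are equal or joined by a line skew to Q (for w, x off Q the line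
-- {w , x , w ⊕ x} is skew iff w ⊕ x is off Q)
joined : V → V → Bool
joined w x = (w == x) ∨ Q (w ⊕ x)

-- the least element of a subset (0 if it is empty)
firstElement : ∀ {n} → Subset (suc n) → Fin (suc n)
firstElement (true ∷ _) = zero
firstElement {zero} (false ∷ []) = zero
firstElement {suc n} (false ∷ t) = suc (firstElement t)

common : V → V → Fin 8
common x y = firstElement (label x ∩ label y)

skewPairᵇ : V → V → Bool
skewPairᵇ x y = Q x ∧ Q y ∧ Q (x ⊕ y) ∧ not (x == y)

SkewPair : V → V → Set
SkewPair x y = T (skewPairᵇ x y)

skewPair : ∀ {x y} → T (Q x) → T (Q y) → T (Q (x ⊕ y)) → x ≢ y → SkewPair x y
skewPair {x} {y} qx qy qxy x≢y = ∧-intro qx (∧-intro qy (∧-intro qxy (≢⇒not== x y x≢y)))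

skewPair-offQ : ∀ x y → SkewPair x y → T (Q x) × T (Q y) × T (Q (x ⊕ y))
skewPair-offQ x y sp = let (qx , qy , rest) = ∧-elim₃ sp in qx , qy , proj₁ (∧-elim rest)

∈-heptad : ∀ k x → T (x ∈ᵇ heptad k) ⇔ (T (Q x) × k ∈ label x)
∈-heptad k x = mk⇔
  (λ x∈ → let (qx , bit) = ∧-elim (∈-tabulate⁻ inHeptad x x∈) in qx , Equivalence.from ∈⇔lookup bit)
  (λ (qx , k∈) → ∈-tabulate⁺ inHeptad x (∧-intro qx (Equivalence.to ∈⇔lookup k∈)))
  where
  inHeptad : V → Bool
  inHeptad w = Q w ∧ lookup (label w) k

∈-triangle : ∀ u x → T (x ∈ᵇ triangle u) ⇔ (T (Q x) × label x ⊆ u)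
∈-triangle u x = mk⇔ to from
  where
  inTriangle : V → Bool
  inTriangle w = Q w ∧ (label w ⊆ᵇ u)
  to : T (x ∈ᵇ triangle u) → T (Q x) × label x ⊆ u
  to x∈ = let (qx , sub) = ∧-elim (∈-tabulate⁻ inTriangle x x∈) in qx , ⊆ᵇ⇒⊆ (label x) u sub
  from : T (Q x) × label x ⊆ u → T (x ∈ᵇ triangle u)
  from (qx , sub) = ∈-tabulate⁺ inTriangle x (∧-intro qx (⊆⇒⊆ᵇ (label x) u sub))

labelsOf-∈ : ∀ S {k} → k ∈ labelsOf S → ∃ λ z → T (z ∈ᵇ S) × k ∈ label z
labelsOf-∈ S {k} k∈ =
  let (z , hit) = anyV-sound (occurs k) (subst T (lookup∘tabulate (anyV ∘ occurs) k) (Equivalence.to ∈⇔lookup k∈))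
      (z∈S , bit) = ∧-elim hit
  in z , z∈S , Equivalence.from ∈⇔lookup bit
  where
  occurs : Fin 8 → V → Bool
  occurs k z = (z ∈ᵇ S) ∧ lookup (label z) k

label-pair : ∀ x → T (Q x) → ∣ label x ∣ ≡ 2 × pointOf (label x) ≡ x
label-pair x qx =
  let (size , inverse) = ∧-elim (⇒ᵇ-elim (Q x) (decided labelIsPair refl x) qx)
  in ≡ᵇ⇒≡ _ _ size , ==-sound _ _ inverse
  where
  labelIsPair : V → Bool
  labelIsPair x = Q x ⇒ᵇ ((∣ label x ∣ ≡ᵇ 2) ∧ (pointOf (label x) == x))

pair-label : ∀ t → ∣ t ∣ ≡ 2 → T (Q (pointOf t)) × label (pointOf t) ≡ t
pair-label t size =
  let (qt , inverse) = ∧-elim (⇒ᵇ-elim (∣ t ∣ ≡ᵇ 2) (decided pairIsLabel refl t) (≡⇒≡ᵇ _ _ size))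
  in qt , ==-sound _ _ inverse
  where
  pairIsLabel : Subset 8 → Bool
  pairIsLabel t = (∣ t ∣ ≡ᵇ 2) ⇒ᵇ (Q (pointOf t) ∧ (label (pointOf t) == t))

heptad-size : ∀ k → count (heptad k) ≡ 7
heptad-size = toWitness {a? = all? (λ k → count (heptad k) ≟ 7)} _

decided-skew : (f : V → V → V → Bool) → allV (λ x → allV (λ y → skewPairᵇ x y ⇒ᵇ allV (f x y))) ≡ true
  → ∀ x y → SkewPair x y → ∀ w → T (f x y w)
decided-skew f eq x y sp =
  allV-sound (f x y) (⇒ᵇ-elim (skewPairᵇ x y) (decided₂ (λ x y → skewPairᵇ x y ⇒ᵇ allV (f x y)) eq x y) sp)

common-label : ∀ x y → SkewPair x y → ∀ w → T (Q w) → T (joined w x) → T (joined w y)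
  → T (w ∈ᵇ heptad (common x y)) ⊎ w ≡ x ⊕ y
common-label x y sp w qw wx wy =
  map₂ (==-sound w (x ⊕ y))
    (∨-elim (⇒ᵇ-elim (Q w ∧ joined w x ∧ joined w y) (decided-skew commonLabelᵇ refl x y sp w)
      (∧-intro qw (∧-intro wx wy))))
  where
  commonLabelᵇ : V → V → V → Bool
  commonLabelᵇ x y w =
    (Q w ∧ joined w x ∧ joined w y) ⇒ᵇ ((w ∈ᵇ heptad (common x y)) ∨ (w == (x ⊕ y)))

joined-to-line : ∀ x y → SkewPair x y → ∀ w → T (Q w) → T (joined w x) → T (joined w y)
  → T (joined w (x ⊕ y)) → T (w ∈ᵇ lineThrough x y)
joined-to-line x y sp w qw wx wy wxy =
  ⇒ᵇ-elim (Q w ∧ joined w x ∧ joined w y ∧ joined w (x ⊕ y)) (decided-skew joinedToLineᵇ refl x y sp w)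
    (∧-intro qw (∧-intro wx (∧-intro wy wxy)))
  where
  joinedToLineᵇ : V → V → V → Bool
  joinedToLineᵇ x y w =
    (Q w ∧ joined w x ∧ joined w y ∧ joined w (x ⊕ y)) ⇒ᵇ (w ∈ᵇ lineThrough x y)

skew-pair-line : ∀ x y → SkewPair x y
  → count (lineThrough x y) ≡ 3 × ∣ label x ∪ label y ∣ ≡ 3 × label (x ⊕ y) ⊆ label x ∪ label y
skew-pair-line x y sp =
  let (points , labels , sum) = ∧-elim₃ (⇒ᵇ-elim (skewPairᵇ x y) (decided₂ skewPairLineᵇ refl x y) sp)
  in ≡ᵇ⇒≡ _ 3 points , ≡ᵇ⇒≡ _ 3 labels , ⊆ᵇ⇒⊆ (label (x ⊕ y)) (label x ∪ label y) sum
  where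
  skewPairLineᵇ : V → V → Bool
  skewPairLineᵇ x y = skewPairᵇ x y ⇒ᵇ
    ((count (lineThrough x y) ≡ᵇ 3) ∧ (∣ label x ∪ label y ∣ ≡ᵇ 3) ∧ (label (x ⊕ y) ⊆ᵇ (label x ∪ label y)))

triangle-line : ∀ u → ∣ u ∣ ≡ 3 → T (isLine (triangle u)) × T (isSkew (triangle u)) × labelsOf (triangle u) ≡ u
triangle-line u size =
  let (line , skew , labels) = ∧-elim₃ (⇒ᵇ-elim (∣ u ∣ ≡ᵇ 3) (decided triangleLineᵇ refl u) (≡⇒≡ᵇ _ _ size))
  in line , skew , ==-sound _ _ labels
  where
  triangleLineᵇ : Subset 8 → Bool
  triangleLineᵇ u = (∣ u ∣ ≡ᵇ 3) ⇒ᵇ (isLine (triangle u) ∧ isSkew (triangle u) ∧ (labelsOf (triangle u) == u))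

∈-lineThrough : ∀ x y z → T ((z == x) ∨ (z == y) ∨ (z == (x ⊕ y))) → T (z ∈ᵇ lineThrough x y)
∈-lineThrough x y z = ∈-tabulate⁺ (λ w → (w == x) ∨ (w == y) ∨ (w == (x ⊕ y))) z

sum∈lineThrough : ∀ x y → T ((x ⊕ y) ∈ᵇ lineThrough x y)
sum∈lineThrough x y = ∈-lineThrough x y (x ⊕ y) (∨-inj₂ ((x ⊕ y) == x) (∨-inj₂ ((x ⊕ y) == y) (==-refl (x ⊕ y))))
  where
  ∨-inj₂ : ∀ a {b} → T b → T (a ∨ b)
  ∨-inj₂ a = Equivalence.from T-∨ ∘ inj₂

lineThrough-⊆ : ∀ x y S → T (x ∈ᵇ S) → T (y ∈ᵇ S) → T ((x ⊕ y) ∈ᵇ S) → lineThrough x y ⊆ˢ S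
lineThrough-⊆ x y S x∈S y∈S s∈S z z∈l
  with ∨-elim (∈-tabulate⁻ (λ w → (w == x) ∨ (w == y) ∨ (w == (x ⊕ y))) z z∈l)
... | inj₁ z=x = subst (λ v → T (v ∈ᵇ S)) (sym (==-sound z x z=x)) x∈S
... | inj₂ rest with ∨-elim rest
...   | inj₁ z=y = subst (λ v → T (v ∈ᵇ S)) (sym (==-sound z y z=y)) y∈S
...   | inj₂ z=s = subst (λ v → T (v ∈ᵇ S)) (sym (==-sound z (x ⊕ y) z=s)) s∈S

skew-offQ : ∀ S → T (isSkew S) → ∀ x → T (x ∈ᵇ S) → T (Q x)
skew-offQ S skew x = ⇒ᵇ-elim (x ∈ᵇ S) (allV-sound (λ w → (w ∈ᵇ S) ⇒ᵇ Q w) skew x)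

skew-sum : ∀ x y → T (isSkew (lineThrough x y)) → T (Q (x ⊕ y))
skew-sum x y skew = skew-offQ (lineThrough x y) skew (x ⊕ y) (sum∈lineThrough x y)

line-count : ∀ S → T (isLine S) → count S ≡ 3
line-count S line = ≡ᵇ⇒≡ (count S) 3 (proj₁ (∧-elim line))

line-closed : ∀ S → T (isLine S) → ∀ x y → T (x ∈ᵇ S) → T (y ∈ᵇ S) → x ≢ y → T ((x ⊕ y) ∈ᵇ S)
line-closed S line x y x∈S y∈S x≢y =
  ⇒ᵇ-elim ((x ∈ᵇ S) ∧ (y ∈ᵇ S) ∧ not (x == y))
    (allV-sound (λ y → closure x y) (allV-sound (λ x → allV (λ y → closure x y)) closed x) y)
    (∧-intro x∈S (∧-intro y∈S (≢⇒not== x y x≢y)))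
  where
  closure : V → V → Bool
  closure x y = ((x ∈ᵇ S) ∧ (y ∈ᵇ S) ∧ not (x == y)) ⇒ᵇ ((x ⊕ y) ∈ᵇ S)
  closed : T (allV λ x → allV λ y → ((x ∈ᵇ S) ∧ (y ∈ᵇ S) ∧ not (x == y)) ⇒ᵇ ((x ⊕ y) ∈ᵇ S))
  closed = proj₂ (∧-elim {not (zeroV ∈ᵇ S)} (proj₂ (∧-elim {count S ≡ᵇ 3} line)))

-- A skew pair spans the triangle of its three labels: the triangle contains
-- x, y and x ⊕ y, and both sets have three points.
line-labels : ∀ x y → SkewPair x y → ∣ label x ∪ label y ∣ ≡ 3 × triangle (label x ∪ label y) ≡ lineThrough x y
line-labels x y sp = size , sym (⊆-count-≡ (lineThrough x y) (triangle u) line⊆triangle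
                                  (≤-reflexive (trans (line-count (triangle u) triangle-is-line) (sym points))))
  where
  u : Subset 8
  u = label x ∪ label y
  points : count (lineThrough x y) ≡ 3
  points = proj₁ (skew-pair-line x y sp)
  size : ∣ u ∣ ≡ 3
  size = proj₁ (proj₂ (skew-pair-line x y sp))
  triangle-is-line : T (isLine (triangle u))
  triangle-is-line = proj₁ (triangle-line u size)
  in-triangle : ∀ z → T (Q z) → label z ⊆ u → T (z ∈ᵇ triangle u)
  in-triangle z qz z⊆u = Equivalence.from (∈-triangle u z) (qz , z⊆u)
  line⊆triangle : lineThrough x y ⊆ˢ triangle u
  line⊆triangle = lineThrough-⊆ x y (triangle u)
    (in-triangle x (proj₁ offQ) (p⊆p∪q (label y))) (in-triangle y (proj₁ (proj₂ offQ)) (q⊆p∪q (label x) (label y)))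
    (in-triangle (x ⊕ y) (proj₂ (proj₂ offQ)) (proj₂ (proj₂ (skew-pair-line x y sp))))
    where
    offQ : T (Q x) × T (Q y) × T (Q (x ⊕ y))
    offQ = skewPair-offQ x y sp

heptad-joined : ∀ {H} → IsConwellHeptad H → ∀ w x → T (w ∈ᵇ H) → T (x ∈ᵇ H) → T (joined w x)
heptad-joined (_ , _ , skew) w x w∈H x∈H with w == x in eq
... | true = tt
... | false = skew-sum w x (skew w x w∈H x∈H w≢x)
  where
  w≢x : w ≢ x
  w≢x refl = subst T eq (==-refl w)

-- All other members are joined to both, hence (common-label) carry that
-- label or equal x ⊕ y; and x ⊕ y is no member, for otherwise the whole heptad
-- would lie on the line xy (joined-to-line).
heptad-of-common : ∀ H → IsConwellHeptad H → ∀ x y → T (x ∈ᵇ H) → T (y ∈ᵇ H) → x ≢ y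
  → H ≡ heptad (common x y)
heptad-of-common H conwell@(|H|≡7 , offQ , skew) x y x∈H y∈H x≢y =
  ⊆-count-≡ H (heptad (common x y)) H⊆heptad (≤-reflexive (trans (heptad-size (common x y)) (sym |H|≡7)))
  where
  sp : SkewPair x y
  sp = skewPair (offQ x x∈H) (offQ y y∈H) (skew-sum x y (skew x y x∈H y∈H x≢y)) x≢y
  joined-to : ∀ z → T (z ∈ᵇ H) → ∀ w → T (w ∈ᵇ H) → T (joined w z)
  joined-to z z∈H w w∈H = heptad-joined conwell w z w∈H z∈H
  sum∉H : ¬ T ((x ⊕ y) ∈ᵇ H)
  sum∉H s∈H = 7≰3 (subst₂ _≤_ |H|≡7 (proj₁ (skew-pair-line x y sp)) (count-mono H (lineThrough x y) H⊆line))
    where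
    H⊆line : H ⊆ˢ lineThrough x y
    H⊆line w w∈H = joined-to-line x y sp w (offQ w w∈H)
      (joined-to x x∈H w w∈H) (joined-to y y∈H w w∈H) (joined-to (x ⊕ y) s∈H w w∈H)
    7≰3 : ¬ 7 ≤ 3
    7≰3 (s≤s (s≤s (s≤s ())))
  H⊆heptad : H ⊆ˢ heptad (common x y)
  H⊆heptad w w∈H = not-sum (common-label x y sp w (offQ w w∈H) (joined-to x x∈H w w∈H) (joined-to y y∈H w w∈H))
    where
    not-sum : T (w ∈ᵇ heptad (common x y)) ⊎ w ≡ x ⊕ y → T (w ∈ᵇ heptad (common x y))
    not-sum (inj₁ w∈heptad) = w∈heptad
    not-sum (inj₂ w≡s) = ⊥-elim (sum∉H (subst (λ v → T (v ∈ᵇ H)) w≡s w∈H))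

heptad-is-labelled : ∀ H → IsConwellHeptad H → ∃ λ k → H ≡ heptad k
heptad-is-labelled H conwell@(|H|≡7 , _) =
  let (x , y , x∈H , y∈H , x≢y) = two-members H (subst (2 ≤_) (sym |H|≡7) (s≤s (s≤s z≤n)))
  in common x y , heptad-of-common H conwell x y x∈H y∈H x≢y

-- A skew line is the triangle of the labels of any two of its points x, y:
-- these form a skew pair, and the line is lineThrough x y (by counting), which
-- is the triangle of label x ∪ label y (line-labels).
skew-line-through : ∀ S → T (isLine S) → T (isSkew S) → ∀ x y → T (x ∈ᵇ S) → T (y ∈ᵇ S) → x ≢ y
  → ∣ label x ∪ label y ∣ ≡ 3 × triangle (label x ∪ label y) ≡ S
skew-line-through S line skew x y x∈S y∈S x≢y =
  proj₁ (line-labels x y sp) ,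
  trans (proj₂ (line-labels x y sp))
    (⊆-count-≡ (lineThrough x y) S (lineThrough-⊆ x y S x∈S y∈S s∈S)
      (≤-reflexive (trans (line-count S line) (sym (proj₁ (skew-pair-line x y sp))))))
  where
  s∈S : T ((x ⊕ y) ∈ᵇ S)
  s∈S = line-closed S line x y x∈S y∈S x≢y
  sp : SkewPair x y
  sp = skewPair (skew-offQ S skew x x∈S) (skew-offQ S skew y y∈S) (skew-offQ S skew (x ⊕ y) s∈S) x≢y

skew-line-triangle : ∀ S → T (isLine S) → T (isSkew S) → ∣ labelsOf S ∣ ≡ 3 × triangle (labelsOf S) ≡ S
skew-line-triangle S line skew =
  let (x , y , x∈S , y∈S , x≢y) = two-members S (subst (2 ≤_) (sym (line-count S line)) (s≤s (s≤s z≤n)))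
      (size , triangle≡S) = skew-line-through S line skew x y x∈S y∈S x≢y
      labels≡u = subst (λ S' → labelsOf S' ≡ label x ∪ label y) triangle≡S
                   (proj₂ (proj₂ (triangle-line (label x ∪ label y) size)))
  in trans (cong ∣_∣ labels≡u) size , trans (cong triangle labels≡u) triangle≡S

Σ-T-≡ : ∀ {A : Set} {P : A → Bool} {a b : Σ A (T ∘ P)} → proj₁ a ≡ proj₁ b → a ≡ b
Σ-T-≡ {a = x , p} {.x , q} refl = cong (x ,_) (T-irrelevant p q)

-- Each is the heptad of a label, so the
-- points surviving are those whose labels avoid the m removed labels: the
-- pairs inside the remaining (8 ∸ m)-set "kept", and the surviving lines are
-- the triangles inside it.

module Removal {m} (H : Fin m → BSet 6) (H-injective : Injective _≡_ _≡_ H)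
                   (conwell : ∀ i → IsConwellHeptad (H i)) where

  labelOf : Fin m → Fin 8
  labelOf i = proj₁ (heptad-is-labelled (H i) (conwell i))

  H≡heptad : ∀ i → H i ≡ heptad (labelOf i)
  H≡heptad i = proj₂ (heptad-is-labelled (H i) (conwell i))

  labelOf-injective : ∀ {i j} → labelOf i ≡ labelOf j → i ≡ j
  labelOf-injective {i} {j} eq = H-injective (trans (H≡heptad i) (trans (cong heptad eq) (sym (H≡heptad j))))

  kept : Subset 8
  kept = ∁ (image labelOf)

  ∣kept∣ : ∣ kept ∣ ≡ 8 ∸ m
  ∣kept∣ = trans (∣∁p∣≡n∸∣p∣ (image labelOf)) (cong (8 ∸_) (∣image∣ labelOf labelOf-injective))

  survives⇔ : ∀ x → T (Q x) → (¬ T (removed H x)) ⇔ label x ⊆ kept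
  survives⇔ x qx = mk⇔ to from
    where
    to : ¬ T (removed H x) → label x ⊆ kept
    to survives {k} k∈ = x∉p⇒x∈∁p λ k∈image →
      let (i , i↦k) = image-∈ labelOf k∈image
          x∈heptad = Equivalence.from (∈-heptad (labelOf i) x) (qx , subst (_∈ label x) (sym i↦k) k∈)
      in survives (anyFin-complete (λ i → x ∈ᵇ H i) i (subst (λ S → T (x ∈ᵇ S)) (sym (H≡heptad i)) x∈heptad))
    from : label x ⊆ kept → ¬ T (removed H x)
    from labels-kept rem =
      let (i , x∈Hi) = anyFin-sound (λ i → x ∈ᵇ H i) rem
          i∈label = proj₂ (Equivalence.to (∈-heptad (labelOf i) x) (subst (λ S → T (x ∈ᵇ S)) (H≡heptad i) x∈Hi))
      in x∈p⇒x∉∁p (∈-image labelOf i) (labels-kept i∈label)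

  pointBij : RemPoint H ↔ Inside 2 kept
  pointBij = mk↔ₛ′ to from
    (λ (t , size , _) → Inside-≡ (proj₂ (pair-label t size)))
    (λ (x , p) → Σ-T-≡ (proj₂ (label-pair x (proj₁ (∧-elim p)))))
    where
    to : RemPoint H → Inside 2 kept
    to (x , p) = let (qx , survives) = ∧-elim p in
      label x , proj₁ (label-pair x qx) , ⊆⇒⊆ᵇ (label x) kept (Equivalence.to (survives⇔ x qx) (not-elim survives))
    from : Inside 2 kept → RemPoint H
    from (t , size , t⊆kept) = let (qt , label≡t) = pair-label t size in
      pointOf t , ∧-intro qt (not-intro (Equivalence.from (survives⇔ (pointOf t) qt)
                    (subst (_⊆ kept) (sym label≡t) (⊆ᵇ⇒⊆ t kept t⊆kept))))

  survivingLine : ∀ S → T (isLine S ∧ isSkew S ∧ allV (λ x → (x ∈ᵇ S) ⇒ᵇ not (removed H x)))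
    → T (isLine S) × T (isSkew S) × (∀ z → T (z ∈ᵇ S) → ¬ T (removed H z))
  survivingLine S p =
    let (line , rest) = ∧-elim p ; (skew , survivors) = ∧-elim rest in
    line , skew , λ z z∈S → not-elim (⇒ᵇ-elim (z ∈ᵇ S) (allV-sound (λ x → (x ∈ᵇ S) ⇒ᵇ not (removed H x)) survivors z) z∈S)

  lineBij : RemLine H ↔ Inside 3 kept
  lineBij = mk↔ₛ′ to from
    (λ (u , size , _) → Inside-≡ (proj₂ (proj₂ (triangle-line u size))))
    (λ (S , p) → let (line , skew , _) = survivingLine S p in Σ-T-≡ (proj₂ (skew-line-triangle S line skew)))
    where
    to : RemLine H → Inside 3 kept
    to (S , p) = let (line , skew , survivors) = survivingLine S p in
      labelsOf S , proj₁ (skew-line-triangle S line skew) , ⊆⇒⊆ᵇ (labelsOf S) kept λ k∈ →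
        let (z , z∈S , k∈z) = labelsOf-∈ S k∈ ; qz = skew-offQ S skew z z∈S in
        Equivalence.to (survives⇔ z qz) (survivors z z∈S) k∈z
    from : Inside 3 kept → RemLine H
    from (u , size , u⊆kept) = let (line , skew , _) = triangle-line u size in
      triangle u , ∧-intro line (∧-intro skew (allV-complete _ λ z → ⇒ᵇ-intro (z ∈ᵇ triangle u) λ z∈ →
        let (qz , label⊆u) = Equivalence.to (∈-triangle u z) z∈ in
        not-intro (Equivalence.from (survives⇔ z qz) (⊆-trans label⊆u (⊆ᵇ⇒⊆ u kept u⊆kept)))))

  incidence : ∀ p l → RemInc H p l ⇔ InsideInc 2 kept (Inverse.to pointBij p) (Inverse.to lineBij l)
  incidence (x , px) (S , pS) = mk⇔ to from
    where
    triangle≡S : triangle (labelsOf S) ≡ S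
    triangle≡S = let (line , skew , _) = survivingLine S pS in proj₂ (skew-line-triangle S line skew)
    to : T (x ∈ᵇ S) → label x ⊆ labelsOf S
    to x∈S = proj₂ (Equivalence.to (∈-triangle (labelsOf S) x) (subst (λ S' → T (x ∈ᵇ S')) (sym triangle≡S) x∈S))
    from : label x ⊆ labelsOf S → T (x ∈ᵇ S)
    from label⊆ = subst (λ S' → T (x ∈ᵇ S')) triangle≡S
      (Equivalence.from (∈-triangle (labelsOf S) x) (proj₁ (∧-elim px) , label⊆))

  removalIso : IncIso (RemPoint H) (RemLine H) (Inside 2 kept) (Inside 3 kept) (RemInc H) (InsideInc 2 kept)
  removalIso = record { pointBij = pointBij ; lineBij = lineBij ; incidence = incidence }

-- The theorem: the removal isomorphism onto G₂ restricted to the kept labels,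
-- followed by the restriction isomorphism onto G₂(∣ kept ∣) = G₂(8 ∸ m).
mainTheorem2 : (m : ℕ) → m ≤ 6 → (H : Fin m → BSet 6)
    → Injective _≡_ _≡_ H → (∀ i → IsConwellHeptad (H i))
    → IncIso (RemPoint H) (RemLine H) (GPoint 2 (8 ∸ m)) (GLine 2 (8 ∸ m))
    (RemInc H) (GInc 2 (8 ∸ m))
mainTheorem2 m _ H H-injective conwell =
  subst (λ N → IncIso (RemPoint H) (RemLine H) (GPoint 2 N) (GLine 2 N) (RemInc H) (GInc 2 N)) ∣kept∣
    (insideIso 2 kept ∘ᴵ removalIso)
  where
  open Removal H H-injective conwell
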